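{- Let $(a_n)_{n\ge1}$ be the sequence with $a_n=2$ if $n\in\{2^1,2^2,2^3,\dots\}$ and $a_n=1$ otherwise (i.e. $1,2,1,2,1,1,1,2,\dots$). Then $(a_n)$ is $\Omega$-divergent.
   Context: An E-sequence is any infinite sequence $(a_n)_{n\ge1}$ of positive integers. For an odd positive integer $x$, its E-sequence is defined by $x_0=x$ and, for $n\ge1$, $x_n=\frac{3x_{n-1}+1}{2^{a_n}}$, where $a_n$ is the exponent of the largest power of $2$ dividing $3x_{n-1}+1$. An E-sequence is $\Omega$-divergent if it is not the E-sequence of any odd positive integer. -}

module Defs where

open import Data.Nat using (ℕ; zero; suc; _+_; _*_; _^_; _/_; _%_; _≤?_)
open import Data.Nat.Properties using (_≟_; m^n≢0)
open import Data.Nat.Logarithm using (⌊log₂_⌋)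
open import Data.Product using (_×_)
open import Relation.Nullary using (¬_)
open import Data.Bool using (if_then_else_; _∧_)
open import Relation.Nullary.Decidable using (⌊_⌋)
open import Relation.Binary.PropositionalEquality using (_≡_)

-- Odd natural number (odd numbers are automatically positive).
Odd : ℕ → Set
Odd x = x % 2 ≡ 1

v2-fuel : ℕ → ℕ → ℕ
v2-fuel zero    m = 0
v2-fuel (suc f) m with m % 2
... | zero  = suc (v2-fuel f (m / 2))
... | suc _ = 0

-- 2-adic valuation: exponent of the largest power of 2 dividing m (m ≥ 1).
-- Fuel m suffices since 2^k ∣ m, m ≥ 1 implies k < m.
ν₂ : ℕ → ℕ
ν₂ m = v2-fuel m m

xs : ℕ → ℕ → ℕ
xs x zero    = x
xs x (suc n) = _/_ (3 * xs x n + 1) (2 ^ ν₂ (3 * xs x n + 1)) {{m^n≢0 2 (ν₂ (3 * xs x n + 1))}}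

-- E-sequence of x, 1-indexed: eseq x (suc n) = a_{n+1} = ν₂(3 x_n + 1).
-- Index 0 is a dummy and is never used.
eseq : ℕ → ℕ → ℕ
eseq x zero    = 0
eseq x (suc n) = ν₂ (3 * xs x n + 1)

-- A sequence is given as a : ℕ → ℕ, with a n = a_n for n ≥ 1 (a 0 ignored).
-- E-sequence: all terms a_n (n ≥ 1) positive.
IsESequence : (ℕ → ℕ) → Set
IsESequence a = ∀ n → 1 Data.Nat.≤ a (suc n)

ΩDivergent : (ℕ → ℕ) → Set
ΩDivergent a = IsESequence a × (∀ x → Odd x → ¬ (∀ n → eseq x (suc n) ≡ a (suc n)))

isPow2≥2 : ℕ → Data.Bool.Bool
isPow2≥2 n = ⌊ 2 ≤? n ⌋ ∧ ⌊ 2 ^ ⌊log₂ n ⌋ ≟ n ⌋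

powSeq : ℕ → ℕ
powSeq n = if isPow2≥2 n then 2 else 1

module Submission where

-- Suppose some x had E-sequence aₙ = 2 at n = 2, 4, 8, … and aₙ = 1 otherwise
-- (x need not even be odd).  Writing the Collatz step as
--   x_{n+1} · 2^{a_{n+1}} = 3 xₙ + 1,
-- every step with aₙ ≥ 1 satisfies 2 (x_{n+1} + 1) ≤ 3 (xₙ + 1), with equality
-- when aₙ = 1.  Hence
--   (growth)  2^N (x_N + 1) ≤ 3^N (x + 1)  for all N, and
--   (runs)    a run of M ones after position N gives
--             2^M (x_{N+M} + 1) = 3^M (x_N + 1), so 2^M ∣ x_N + 1.
-- Together, a run of M ones after position N forces 2^N · 2^M ≤ 3^N (x + 1).
-- For our sequence, after N = M + 1 = 2^k there is a run of M ones, so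
-- 2 · 4^M ≤ 3 · 3^M (x + 1), and since (4/3)^M ≥ (M + 3)/3 this gives
-- 2 (M + 3) ≤ 9 (x + 1), which fails once M ≥ 5x + 2.
-- The file proves: generic recurrence bounds, 2-adic facts, the Collatz step
-- identities, the two orbit estimates, facts about powSeq, and finally the
-- corollary.

open import Defs
open import Data.Nat
open import Data.Nat.Properties
open import Data.Nat.Divisibility
open import Data.Nat.DivMod using (m/n*n≡m; m*[n/m]≡n)
open import Data.Nat.Primality using (prime[2]; euclidsLemma)
open import Data.Nat.Logarithm using (⌊log₂_⌋)
open import Data.Nat.Tactic.RingSolver using (solve-∀)
open import Data.Product using (_,_)
open import Function using (_∘_)
open import Data.Sum using (inj₁; inj₂)
open import Data.Empty using (⊥-elim)
open import Data.Bool using (true; false)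
open import Relation.Nullary using (¬_; yes; no)
open import Relation.Binary.PropositionalEquality

interchange : ∀ a b c → a * b * c ≡ b * (a * c)
interchange = solve-∀

geometric-bound : ∀ (f : ℕ → ℕ) c d → (∀ n → d * f (suc n) ≤ c * f n) →
                  ∀ n → d ^ n * f n ≤ c ^ n * f 0
geometric-bound f c d step zero    = ≤-refl
geometric-bound f c d step (suc n) = begin
  d * d ^ n * f (suc n)   ≡⟨ interchange d (d ^ n) (f (suc n)) ⟩
  d ^ n * (d * f (suc n)) ≤⟨ *-monoʳ-≤ (d ^ n) (step n) ⟩
  d ^ n * (c * f n)       ≡⟨ sym (interchange c (d ^ n) (f n)) ⟩
  c * d ^ n * f n         ≡⟨ *-assoc c (d ^ n) (f n) ⟩
  c * (d ^ n * f n)       ≤⟨ *-monoʳ-≤ c (geometric-bound f c d step n) ⟩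
  c * (c ^ n * f 0)       ≡⟨ *-assoc c (c ^ n) (f 0) ⟨
  c * c ^ n * f 0         ∎
  where open ≤-Reasoning

geometric-run : ∀ (f : ℕ → ℕ) c d m → (∀ i → i < m → d * f (suc i) ≡ c * f i) →
                d ^ m * f m ≡ c ^ m * f 0
geometric-run f c d zero    step = refl
geometric-run f c d (suc m) step = begin
  d * d ^ m * f (suc m)   ≡⟨ interchange d (d ^ m) (f (suc m)) ⟩
  d ^ m * (d * f (suc m)) ≡⟨ cong (d ^ m *_) (step m ≤-refl) ⟩
  d ^ m * (c * f m)       ≡⟨ sym (interchange c (d ^ m) (f m)) ⟩
  c * d ^ m * f m         ≡⟨ *-assoc c (d ^ m) (f m) ⟩
  c * (d ^ m * f m)       ≡⟨ cong (c *_) (geometric-run f c d m (λ i i<m → step i (m<n⇒m<1+n i<m))) ⟩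
  c * (c ^ m * f 0)       ≡⟨ *-assoc c (c ^ m) (f 0) ⟨
  c * c ^ m * f 0         ∎
  where open ≡-Reasoning

2∤3 : ¬ 2 ∣ 3
2∤3 2∣3 with n∣m⇒m%n≡0 3 2 2∣3
... | ()

two∣3^j*z⇒two∣z : ∀ j z → 2 ∣ 3 ^ j * z → 2 ∣ z
two∣3^j*z⇒two∣z zero    z 2∣z   = subst (2 ∣_) (*-identityˡ z) 2∣z
two∣3^j*z⇒two∣z (suc j) z 2∣3jz
  with euclidsLemma 3 (3 ^ j * z) prime[2] (subst (2 ∣_) (*-assoc 3 (3 ^ j) z) 2∣3jz)
... | inj₁ 2∣3    = ⊥-elim (2∤3 2∣3)
... | inj₂ 2∣rest = two∣3^j*z⇒two∣z j z 2∣rest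

2^k∣3^j*z⇒2^k∣z : ∀ k j z → 2 ^ k ∣ 3 ^ j * z → 2 ^ k ∣ z
2^k∣3^j*z⇒2^k∣z zero    j z _ = 1∣ z
2^k∣3^j*z⇒2^k∣z (suc k) j z d with two∣3^j*z⇒two∣z j z (∣-trans (m∣m*n (2 ^ k)) d)
... | divides w refl = subst (2 * 2 ^ k ∣_) (*-comm 2 w) (*-monoʳ-∣ 2 (2^k∣3^j*z⇒2^k∣z k j w halved))
  where
  halved : 2 ^ k ∣ 3 ^ j * w
  halved = *-cancelˡ-∣ 2 (subst (2 * 2 ^ k ∣_) (factor-two (3 ^ j) w) d)
    where
    factor-two : ∀ a w → a * (w * 2) ≡ 2 * (a * w)
    factor-two = solve-∀

2^v2-fuel∣ : ∀ f m → 2 ^ v2-fuel f m ∣ m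
2^v2-fuel∣ zero    m = 1∣ m
2^v2-fuel∣ (suc f) m with m % 2 in m%2≡r
... | zero  = subst (2 * 2 ^ v2-fuel f (m / 2) ∣_) (m*[n/m]≡n (m%n≡0⇒n∣m m 2 m%2≡r))
                (*-monoʳ-∣ 2 (2^v2-fuel∣ f (m / 2)))
... | suc _ = 1∣ m

collatz-step : ∀ x n → xs x (suc n) * 2 ^ eseq x (suc n) ≡ 3 * xs x n + 1
collatz-step x n = m/n*n≡m {{m^n≢0 2 (ν₂ m)}} (2^v2-fuel∣ m m)
  where m = 3 * xs x n + 1

double-succ : ∀ y → 2 * (y + 1) ≡ y * 2 ^ 1 + 2
double-succ = solve-∀

triple-succ : ∀ y → 3 * y + 1 + 2 ≡ 3 * (y + 1)
triple-succ = solve-∀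

step-exact : ∀ y y′ → y′ * 2 ^ 1 ≡ 3 * y + 1 → 2 * (y′ + 1) ≡ 3 * (y + 1)
step-exact y y′ step = begin
  2 * (y′ + 1)    ≡⟨ double-succ y′ ⟩
  y′ * 2 ^ 1 + 2  ≡⟨ cong (_+ 2) step ⟩
  3 * y + 1 + 2   ≡⟨ triple-succ y ⟩
  3 * (y + 1)     ∎
  where open ≡-Reasoning

step-growth : ∀ y y′ a → 1 ≤ a → y′ * 2 ^ a ≡ 3 * y + 1 → 2 * (y′ + 1) ≤ 3 * (y + 1)
step-growth y y′ a 1≤a step = begin
  2 * (y′ + 1)    ≡⟨ double-succ y′ ⟩
  y′ * 2 ^ 1 + 2  ≤⟨ +-monoˡ-≤ 2 (*-monoʳ-≤ y′ (^-monoʳ-≤ 2 1≤a)) ⟩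
  y′ * 2 ^ a + 2  ≡⟨ cong (_+ 2) step ⟩
  3 * y + 1 + 2   ≡⟨ triple-succ y ⟩
  3 * (y + 1)     ∎
  where open ≤-Reasoning

orbit-growth : ∀ x → (∀ n → 1 ≤ eseq x (suc n)) →
               ∀ N → 2 ^ N * (xs x N + 1) ≤ 3 ^ N * (x + 1)
orbit-growth x pos = geometric-bound (λ n → xs x n + 1) 3 2
  (λ n → step-growth (xs x n) (xs x (suc n)) _ (pos n) (collatz-step x n))

run-of-ones-divides : ∀ x N M → (∀ i → i < M → eseq x (suc (i + N)) ≡ 1) →
                      2 ^ M ∣ xs x N + 1
run-of-ones-divides x N M ones =
  2^k∣3^j*z⇒2^k∣z M M (xs x N + 1) (divides (g M) (trans (sym run) (*-comm (2 ^ M) (g M))))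
  where
  g : ℕ → ℕ
  g i = xs x (i + N) + 1
  run : 2 ^ M * g M ≡ 3 ^ M * g 0
  run = geometric-run g 3 2 M (λ i i<M → step-exact (xs x (i + N)) (xs x (suc (i + N)))
          (subst (λ a → xs x (suc (i + N)) * 2 ^ a ≡ 3 * xs x (i + N) + 1)
                 (ones i i<M) (collatz-step x (i + N))))

run-of-ones-bound : ∀ x → (∀ n → 1 ≤ eseq x (suc n)) → ∀ N M →
                    (∀ i → i < M → eseq x (suc (i + N)) ≡ 1) →
                    2 ^ N * 2 ^ M ≤ 3 ^ N * (x + 1)
run-of-ones-bound x pos N M ones = ≤-trans
  (*-monoʳ-≤ (2 ^ N) (∣⇒≤ {{>-nonZero (m≤n+m 1 (xs x N))}} (run-of-ones-divides x N M ones)))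
  (orbit-growth x pos N)

^-cancelʳ-< : ∀ b .{{_ : NonZero b}} {m n} → b ^ m < b ^ n → m < n
^-cancelʳ-< b {m} {n} bᵐ<bⁿ = ≰⇒> (λ n≤m → <⇒≱ bᵐ<bⁿ (^-monoʳ-≤ b n≤m))

powSeq-between : ∀ k n → 2 ^ k < n → n < 2 ^ suc k → powSeq n ≡ 1
powSeq-between k n lo hi with 2 ≤? n
... | no _ = refl
... | yes _ with 2 ^ ⌊log₂ n ⌋ ≟ n
...   | no _ = refl
...   | yes 2^l≡n = ⊥-elim (<⇒≱ k<l (s≤s⁻¹ l<1+k))
  where
  l = ⌊log₂ n ⌋
  k<l : k < l
  k<l = ^-cancelʳ-< 2 {k} {l} (subst (2 ^ k <_) (sym 2^l≡n) lo)
  l<1+k : l < suc k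
  l<1+k = ^-cancelʳ-< 2 {l} {suc k} (subst (_< 2 ^ suc k) (sym 2^l≡n) hi)

powSeq-run : ∀ M k → suc M ≡ 2 ^ k → ∀ i → i < M → powSeq (suc (i + suc M)) ≡ 1
powSeq-run M k N≡2^k i i<M = powSeq-between k (suc (i + suc M))
  (subst (_< suc (i + suc M)) N≡2^k (s≤s (m≤n+m (suc M) i)))
  (subst (suc (i + suc M) <_) (cong (2 *_) N≡2^k)
    (≤-trans (+-monoˡ-≤ (suc M) (s≤s i<M)) (≤-reflexive (cong (suc M +_) (sym (+-identityʳ (suc M)))))))

powSeq-positive : ∀ n → 1 ≤ powSeq n
powSeq-positive n with isPow2≥2 n
... | true  = s≤s z≤n
... | false = ≤-refl

n<2^n : ∀ n → n < 2 ^ n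
n<2^n zero    = s≤s z≤n
n<2^n (suc n) = begin-strict
  suc n          ≤⟨ n<2^n n ⟩
  2 ^ n          <⟨ m<m+n (2 ^ n) (m^n>0 2 n) ⟩
  2 ^ n + 2 ^ n  ≡⟨ cong (2 ^ n +_) (+-identityʳ (2 ^ n)) ⟨
  2 * 2 ^ n      ∎
  where open ≤-Reasoning

3^n*[n+3]≤3*4^n : ∀ n → 3 ^ n * (n + 3) ≤ 3 * (2 ^ n * 2 ^ n)
3^n*[n+3]≤3*4^n zero    = ≤-refl
3^n*[n+3]≤3*4^n (suc n) = begin
  3 * A * (suc n + 3)       ≡⟨ expand A n ⟩
  3 * (A * (n + 3)) + A * 3 ≤⟨ +-monoʳ-≤ (3 * (A * (n + 3))) (*-monoʳ-≤ A (m≤n+m 3 n)) ⟩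
  3 * (A * (n + 3)) + A * (n + 3) ≡⟨ collect (A * (n + 3)) ⟩
  4 * (A * (n + 3))         ≤⟨ *-monoʳ-≤ 4 (3^n*[n+3]≤3*4^n n) ⟩
  4 * (3 * (P * P))         ≡⟨ regroup P ⟩
  3 * (2 * P * (2 * P))     ∎
  where
  open ≤-Reasoning
  A = 3 ^ n
  P = 2 ^ n
  expand : ∀ A n → 3 * A * (suc n + 3) ≡ 3 * (A * (n + 3)) + A * 3
  expand = solve-∀
  collect : ∀ B → 3 * B + B ≡ 4 * B
  collect = solve-∀
  regroup : ∀ P → 4 * (3 * (P * P)) ≡ 3 * (2 * P * (2 * P))
  regroup = solve-∀

long-run-bound : ∀ M y → 2 * 2 ^ M * 2 ^ M ≤ 3 * 3 ^ M * y → 2 * (M + 3) ≤ 9 * y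
long-run-bound M y bound = *-cancelˡ-≤ A {{m^n≢0 3 M}} (begin
  A * (2 * (M + 3))        ≡⟨ swap A 2 (M + 3) ⟩
  2 * (A * (M + 3))        ≤⟨ *-monoʳ-≤ 2 (3^n*[n+3]≤3*4^n M) ⟩
  2 * (3 * (P * P))        ≡⟨ regroup P ⟩
  3 * (2 * P * P)          ≤⟨ *-monoʳ-≤ 3 bound ⟩
  3 * (3 * A * y)          ≡⟨ regroup′ A y ⟩
  A * (9 * y)              ∎)
  where
  open ≤-Reasoning
  A = 3 ^ M
  P = 2 ^ M
  swap : ∀ a b c → a * (b * c) ≡ b * (a * c)
  swap = solve-∀
  regroup : ∀ P → 2 * (3 * (P * P)) ≡ 3 * (2 * P * P)
  regroup = solve-∀
  regroup′ : ∀ A y → 3 * (3 * A * y) ≡ A * (9 * y)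
  regroup′ = solve-∀

too-long : ∀ x M → 5 * x + 2 ≤ M → ¬ (2 * (M + 3) ≤ 9 * (x + 1))
too-long x M 5x+2≤M bound = m+1+n≰m (9 * (x + 1)) (begin
  9 * (x + 1) + suc x    ≡⟨ expand x ⟩
  2 * (5 * x + 2 + 3)    ≤⟨ *-monoʳ-≤ 2 (+-monoˡ-≤ 3 5x+2≤M) ⟩
  2 * (M + 3)            ≤⟨ bound ⟩
  9 * (x + 1)            ∎)
  where
  open ≤-Reasoning
  expand : ∀ x → 9 * (x + 1) + suc x ≡ 2 * (5 * x + 2 + 3)
  expand = solve-∀

corollary4p12 : ΩDivergent powSeq
corollary4p12 = powSeq-positive ∘ suc , no-orbit
  where
  no-orbit : ∀ x → Odd x → ¬ (∀ n → eseq x (suc n) ≡ powSeq (suc n))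
  no-orbit x _ same = too-long x M k≤M
    (long-run-bound M (x + 1) (run-of-ones-bound x positive (suc M) M ones))
    where
    k = 5 * x + 2
    M = pred (2 ^ k)
    M+1≡2^k : suc M ≡ 2 ^ k
    M+1≡2^k = suc-pred (2 ^ k) {{m^n≢0 2 k}}
    k≤M : k ≤ M
    k≤M = s≤s⁻¹ (subst (k <_) (sym M+1≡2^k) (n<2^n k))
    positive : ∀ n → 1 ≤ eseq x (suc n)
    positive n = subst (1 ≤_) (sym (same n)) (powSeq-positive (suc n))
    ones : ∀ i → i < M → eseq x (suc (i + suc M)) ≡ 1
    ones i i<M = trans (same (i + suc M)) (powSeq-run M k M+1≡2^k i i<M)
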